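{- The clairvoyance gap for scheduling on related machines is $O(\sqrt m)$, where $m$ is the number of machines.
   Context: Scheduling on related machines: $m$ machines with speeds $s_i>0$, jobs with sizes $p_j\ge0$; assigning job $j$ to machine $i$ adds $p_j/s_i$ to the load of $i$; the makespan is the maximum load. A non-clairvoyant algorithm has no prior knowledge of job sizes and decides where to place each job using only current machine loads and speeds; after each assignment, an adversary chooses the job's realized size, which the algorithm then observes. The clairvoyance gap is the maximum (over instances with $m$ machines) ratio between the makespan of an optimal non-clairvoyant algorithm and the optimal makespan of a clairvoyant offline algorithm knowing all jobs and sizes in advance.
   Formalization: The machine speeds $s_i>0$ and the job sizes $p_j\ge0$ are rational, so the machine loads seen by the non-clairvoyant algorithm are rational as well. -}

module Defs where

open import Data.Nat using (ℕ; zero; suc)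
open import Data.Fin using (Fin; zero; suc; _≟_)
open import Data.List using (List; []; _∷_; length)
open import Data.Product using (Σ; _,_; proj₁)
open import Data.Rational using (ℚ; 0ℚ; _+_; _÷_; _⊔_; Positive)
open import Data.Rational.Properties using (pos⇒nonZero)
open import Relation.Nullary using (yes; no)

Speed : Set
Speed = Σ ℚ Positive

Speeds : ℕ → Set
Speeds m = Fin m → Speed

Loads : ℕ → Set
Loads m = Fin m → ℚ

timeOn : ℚ → Speed → ℚ
timeOn p (s , pos) = (p ÷ s) {{pos⇒nonZero s {{pos}}}}

addJob : ∀ {m} → Speeds m → Loads m → Fin m → ℚ → Loads m
addJob s L i p k with k ≟ i
... | yes _ = L k + timeOn p (s k)
... | no  _ = L k

zeroLoads : ∀ {m} → Loads m
zeroLoads _ = 0ℚ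

makespan : ∀ {k} → Loads (suc k) → ℚ
makespan {zero}  L = L zero
makespan {suc k} L = L zero ⊔ makespan {k} (λ i → L (suc i))

-- A non-clairvoyant algorithm: given the speeds and the current loads,
-- choose the machine for the next job (its size is not known).
NCAlg : ℕ → Set
NCAlg m = Speeds m → Loads m → Fin m

runFrom : ∀ {m} → NCAlg m → Speeds m → Loads m → List ℚ → Loads m
runFrom A s L []       = L
runFrom A s L (p ∷ ps) = runFrom A s (addJob s L (A s L) p) ps

runAlg : ∀ {m} → NCAlg m → Speeds m → List ℚ → Loads m
runAlg A s ps = runFrom A s zeroLoads ps

-- Loads of a fixed (clairvoyant, offline) assignment σ of jobs to machines.
assignLoads : ∀ {m} → Speeds m → (ps : List ℚ) → (Fin (length ps) → Fin m) → Loads m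
assignLoads s []       σ = zeroLoads
assignLoads s (p ∷ ps) σ =
  addJob s (assignLoads s ps (λ j → σ (suc j))) (σ zero) p

-- Let M be the largest speed, q ≈ √m, and call a machine fast if its speed is at least M/q.
-- The algorithm sends every job to the currently least loaded fast machine. If T is the
-- optimal makespan, every job has size at most M·T, so it adds at most M·T/sᵢ ≤ q·T to the
-- load of a fast machine i, and the fast loads stay within q·T of the least one, a. Every
-- fast load is at least a, so a·Σ_fast sᵢ ≤ work ≤ T·Σ sᵢ ≤ T·(Σ_fast sᵢ + m·M/q), and
-- M ≤ Σ_fast sᵢ gives a ≤ (1 + m/q)·T. Hence the makespan is at most
-- (1 + m/q + q)·T ≤ 3q·T ≤ 6√m·T.

module Submission where

open import Defs
open import Data.Nat using (ℕ; zero; suc; z≤n; s≤s)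
import Data.Nat as ℕ
import Data.Nat.Properties as ℕₚ
import Data.Nat.Solver
import Data.Nat.Coprimality as Coprime
open import Data.Integer using (+_)
import Data.Integer as ℤ
import Data.Integer.Properties as ℤₚ
open import Data.Rational
  using (ℚ; 0ℚ; 1ℚ; _≤_; _<_; _*_; _+_; _/_; mkℚ; *≤*; _≤?_; 1/_; NonZero; NonNegative; positive; nonNegative)
open import Data.Rational.Properties hiding (_≟_)
open import Data.Rational.Solver using (module +-*-Solver)
open import Algebra.Bundles using (CommutativeRing)
open import Relation.Binary.Bundles using (DecTotalOrder)
open import Algebra.Properties.Semiring.Sum (CommutativeRing.semiring +-*-commutativeRing)
  using (sum; sum-cong-≗; sum-replicate-zero; sum-remove; ∑-distrib-+; *-distribˡ-sum; *-distribʳ-sum)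
open import Data.Fin using (Fin; zero; suc; _≟_; punchIn)
open import Data.Fin.Properties using (punchInᵢ≢i)
open import Data.List using (List; []; _∷_; length; filter; allFin; foldr)
open import Data.List.Relation.Unary.All as All using (All; []; _∷_)
open import Data.List.Relation.Unary.All.Properties using (all-filter)
open import Data.List.Membership.Propositional.Properties using (∈-filter⁺; ∈-allFin)
open import Data.List.Extrema (DecTotalOrder.totalOrder ≤-decTotalOrder)
  using (argmin; argmax; argmin-all; f[argmin]≤f[xs]; f[xs]≤f[argmax])
open import Data.Product using (∃; Σ; _×_; _,_; proj₁; proj₂)
open import Data.Sum using (inj₁; inj₂)
open import Function using (_∘_; case_of_)
open import Relation.Binary.PropositionalEquality
open import Relation.Nullary using (¬_; yes; no; contradiction)
open import Relation.Unary using (Decidable)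

fromℕ : ℕ → ℚ
fromℕ n = + n / 1

private
  fromℕ≡mkℚ : ∀ n → fromℕ n ≡ mkℚ (+ n) 0 (Coprime.sym (Coprime.1-coprimeTo n))
  fromℕ≡mkℚ n = normalize-coprime (Coprime.sym (Coprime.1-coprimeTo n))

fromℕ-+ : ∀ m n → fromℕ (m ℕ.+ n) ≡ fromℕ m + fromℕ n
fromℕ-+ m n rewrite fromℕ≡mkℚ m | fromℕ≡mkℚ n =
  /-cong (trans (ℤₚ.pos-+ m n) (sym (cong₂ ℤ._+_ (ℤₚ.*-identityʳ (+ m)) (ℤₚ.*-identityʳ (+ n))))) refl

fromℕ-* : ∀ m n → fromℕ (m ℕ.* n) ≡ fromℕ m * fromℕ n
fromℕ-* m n rewrite fromℕ≡mkℚ m | fromℕ≡mkℚ n = /-cong (ℤₚ.pos-* m n) refl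

fromℕ-mono-≤ : ∀ {m n} → m ℕ.≤ n → fromℕ m ≤ fromℕ n
fromℕ-mono-≤ {m} {n} m≤n rewrite fromℕ≡mkℚ m | fromℕ≡mkℚ n =
  *≤* (ℤₚ.*-monoʳ-≤-nonNeg (+ 1) (ℤ.+≤+ m≤n))

fromℕ-nonNeg : ∀ n → 0ℚ ≤ fromℕ n
fromℕ-nonNeg n = fromℕ-mono-≤ {0} {n} z≤n

approx-sqrt : ∀ k → ∃ λ q → 1 ℕ.≤ q × suc k ℕ.≤ q ℕ.* q × q ℕ.* q ℕ.≤ 4 ℕ.* suc k
approx-sqrt zero = 1 , s≤s z≤n , s≤s z≤n , s≤s z≤n
approx-sqrt (suc k) with approx-sqrt k
... | q , 1≤q , m≤q² , q²≤4m with suc (suc k) ℕ.≤? q ℕ.* q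
...   | yes m+1≤q² = q , 1≤q , m+1≤q² , ℕₚ.≤-trans q²≤4m (ℕₚ.*-monoʳ-≤ 4 (ℕₚ.n≤1+n (suc k)))
...   | no m+1≰q² = suc q , s≤s z≤n , m+1≤[q+1]² , [q+1]²≤4[m+1]
  where
  open ℕₚ.≤-Reasoning
  open Data.Nat.Solver.+-*-Solver
  m+1≤[q+1]² : suc (suc k) ℕ.≤ suc q ℕ.* suc q
  m+1≤[q+1]² = begin
    suc (suc k)      ≤⟨ s≤s m≤q² ⟩
    suc (q ℕ.* q)    ≤⟨ s≤s (ℕₚ.≤-trans (ℕₚ.*-monoʳ-≤ q (ℕₚ.n≤1+n q)) (ℕₚ.m≤n+m _ q)) ⟩
    suc q ℕ.* suc q  ∎
  [q+1]²≤4[m+1] : suc q ℕ.* suc q ℕ.≤ 4 ℕ.* suc (suc k)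
  [q+1]²≤4[m+1] = begin
    suc q ℕ.* suc q          ≤⟨ ℕₚ.*-mono-≤ (ℕₚ.+-monoˡ-≤ q 1≤q) (ℕₚ.+-monoˡ-≤ q 1≤q) ⟩
    (q ℕ.+ q) ℕ.* (q ℕ.+ q)  ≡⟨ solve 1 (λ x → (x :+ x) :* (x :+ x) := con 4 :* (x :* x)) refl q ⟩
    4 ℕ.* (q ℕ.* q)          ≤⟨ ℕₚ.*-monoʳ-≤ 4 (ℕₚ.≤-pred (ℕₚ.≰⇒> m+1≰q²)) ⟩
    4 ℕ.* suc k              ≤⟨ ℕₚ.*-monoʳ-≤ 4 (ℕₚ.n≤1+n (suc k)) ⟩
    4 ℕ.* suc (suc k)        ∎

p≤p+q : ∀ {p q} → 0ℚ ≤ q → p ≤ p + q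
p≤p+q {p} {q} 0≤q = subst (_≤ p + q) (+-identityʳ p) (+-monoʳ-≤ p 0≤q)

q≤p+q : ∀ {p q} → 0ℚ ≤ p → q ≤ p + q
q≤p+q {p} {q} 0≤p = subst (_≤ p + q) (+-identityˡ q) (+-monoˡ-≤ q 0≤p)

square-mono-≤ : ∀ {x y} → 0ℚ ≤ x → x ≤ y → x * x ≤ y * y
square-mono-≤ {x} {y} 0≤x x≤y = begin
  x * x  ≤⟨ *-monoˡ-≤-nonNeg x {{nonNegative 0≤x}} x≤y ⟩
  x * y  ≤⟨ *-monoʳ-≤-nonNeg y {{nonNegative (≤-trans 0≤x x≤y)}} x≤y ⟩
  y * y  ∎
  where open ≤-Reasoning

sum-mono-≤ : ∀ {n} {f g : Fin n → ℚ} → (∀ i → f i ≤ g i) → sum f ≤ sum g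
sum-mono-≤ {zero}  _   = ≤-refl
sum-mono-≤ {suc n} f≤g = +-mono-≤ (f≤g zero) (sum-mono-≤ (f≤g ∘ suc))

sum-nonNeg : ∀ {n} {f : Fin n → ℚ} → (∀ i → 0ℚ ≤ f i) → 0ℚ ≤ sum f
sum-nonNeg {n} {f} 0≤f = subst (_≤ sum f) (sum-replicate-zero n) (sum-mono-≤ {f = λ _ → 0ℚ} 0≤f)

≤-sum : ∀ {n} {f : Fin (suc n) → ℚ} → (∀ i → 0ℚ ≤ f i) → ∀ i → f i ≤ sum f
≤-sum {f = f} 0≤f i = begin
  f i                          ≡⟨ +-identityʳ (f i) ⟨
  f i + 0ℚ                     ≤⟨ +-monoʳ-≤ (f i) (sum-nonNeg (0≤f ∘ punchIn i)) ⟩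
  f i + sum (f ∘ punchIn i)    ≡⟨ sum-remove f ⟨
  sum f                        ∎
  where open ≤-Reasoning

sum-const : ∀ n c → sum {n} (λ _ → c) ≡ fromℕ n * c
sum-const zero    c = sym (*-zeroˡ c)
sum-const (suc n) c = begin
  c + sum {n} (λ _ → c)     ≡⟨ cong (_+_ c) (sum-const n c) ⟩
  c + fromℕ n * c           ≡⟨ cong (_+ fromℕ n * c) (*-identityˡ c) ⟨
  1ℚ * c + fromℕ n * c      ≡⟨ *-distribʳ-+ c 1ℚ (fromℕ n) ⟨
  (1ℚ + fromℕ n) * c        ≡⟨ cong (_* c) (fromℕ-+ 1 n) ⟨
  fromℕ (suc n) * c         ∎
  where open ≡-Reasoning

speed>0 : (s : Speed) → 0ℚ < proj₁ s
speed>0 (v , v>0) = positive⁻¹ v {{v>0}}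

speed-nonNeg : (s : Speed) → NonNegative (proj₁ s)
speed-nonNeg (v , v>0) = pos⇒nonNeg v {{v>0}}

speed*-mono-≤ : ∀ (s : Speed) {p q} → p ≤ q → proj₁ s * p ≤ proj₁ s * q
speed*-mono-≤ s = *-monoˡ-≤-nonNeg (proj₁ s) {{speed-nonNeg s}}

speed*timeOn : ∀ p (s : Speed) → proj₁ s * timeOn p s ≡ p
speed*timeOn p (v , v>0) = begin
  v * (p * 1/ v)  ≡⟨ solve 3 (λ v p w → v :* (p :* w) := p :* (v :* w)) refl v p (1/ v) ⟩
  p * (v * 1/ v)  ≡⟨ cong (_*_ p) (*-inverseʳ v) ⟩
  p * 1ℚ          ≡⟨ *-identityʳ p ⟩
  p               ∎
  where
  open ≡-Reasoning
  open +-*-Solver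
  instance
    v≢0 : NonZero v
    v≢0 = pos⇒nonZero v {{v>0}}

timeOn-≤ : ∀ {p y} s → p ≤ proj₁ s * y → timeOn p s ≤ y
timeOn-≤ {p} {y} s@(v , v>0) p≤vy =
  *-cancelˡ-≤-pos v {{v>0}} (subst (_≤ v * y) (sym (speed*timeOn p s)) p≤vy)

≤-timeOn : ∀ {p y} s → proj₁ s * y ≤ p → y ≤ timeOn p s
≤-timeOn {p} {y} s@(v , v>0) vy≤p =
  *-cancelˡ-≤-pos v {{v>0}} (subst (v * y ≤_) (sym (speed*timeOn p s)) vy≤p)

timeOn-mono-≤ : ∀ {p q} s → p ≤ q → timeOn p s ≤ timeOn q s
timeOn-mono-≤ {p} {q} s p≤q = timeOn-≤ s (subst (p ≤_) (sym (speed*timeOn q s)) p≤q)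

timeOn-nonNeg : ∀ {p} s → 0ℚ ≤ p → 0ℚ ≤ timeOn p s
timeOn-nonNeg {p} s 0≤p = ≤-timeOn s (subst (_≤ p) (sym (*-zeroʳ (proj₁ s))) 0≤p)

addJob-hit : ∀ {m} (s : Speeds m) L i p → addJob s L i p i ≡ L i + timeOn p (s i)
addJob-hit s L i p with i ≟ i
... | yes _  = refl
... | no i≢i = contradiction refl i≢i

addJob-miss : ∀ {m} (s : Speeds m) L r p {i} → i ≢ r → addJob s L r p i ≡ L i
addJob-miss s L r p {i} i≢r with i ≟ r
... | yes i≡r = contradiction i≡r i≢r
... | no _    = refl

addJob-inflationary : ∀ {m} (s : Speeds m) L r {p} → 0ℚ ≤ p → ∀ i → L i ≤ addJob s L r p i
addJob-inflationary s L r {p} 0≤p i with i ≟ r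
... | yes refl = p≤p+q (timeOn-nonNeg (s i) 0≤p)
... | no _     = ≤-refl

runFrom-nonNeg : ∀ {m} (A : NCAlg m) s {L} ps → All (0ℚ ≤_) ps →
                 (∀ i → 0ℚ ≤ L i) → ∀ i → 0ℚ ≤ runFrom A s L ps i
runFrom-nonNeg A s []       []           0≤L = 0≤L
runFrom-nonNeg A s {L} (p ∷ ps) (0≤p ∷ 0≤ps) 0≤L = runFrom-nonNeg A s ps 0≤ps
  (λ i → ≤-trans (0≤L i) (addJob-inflationary s L (A s L) 0≤p i))

assignLoads-nonNeg : ∀ {m} (s : Speeds m) ps σ → All (0ℚ ≤_) ps → ∀ i → 0ℚ ≤ assignLoads s ps σ i
assignLoads-nonNeg s []       σ []           i = ≤-refl
assignLoads-nonNeg s (p ∷ ps) σ (0≤p ∷ 0≤ps) i = ≤-trans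
  (assignLoads-nonNeg s ps (σ ∘ suc) 0≤ps i)
  (addJob-inflationary s (assignLoads s ps (σ ∘ suc)) (σ zero) 0≤p i)

assignLoads-jobs : ∀ {m} (s : Speeds m) ps σ → All (0ℚ ≤_) ps →
                   All (λ p → ∃ λ i → timeOn p (s i) ≤ assignLoads s ps σ i) ps
assignLoads-jobs s []       σ []           = []
assignLoads-jobs s (p ∷ ps) σ (0≤p ∷ 0≤ps) =
  (r , subst (timeOn p (s r) ≤_) (sym (addJob-hit s L r p)) (q≤p+q (assignLoads-nonNeg s ps (σ ∘ suc) 0≤ps r)))
  ∷ All.map (λ (i , le) → i , ≤-trans le (addJob-inflationary s L r 0≤p i)) (assignLoads-jobs s ps (σ ∘ suc) 0≤ps)
  where
  r = σ zero
  L = assignLoads s ps (σ ∘ suc)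

load≤makespan : ∀ {k} (L : Loads (suc k)) i → L i ≤ makespan L
load≤makespan {zero}  L zero    = ≤-refl
load≤makespan {suc k} L zero    = p≤p⊔q (L zero) _
load≤makespan {suc k} L (suc i) = ≤-trans (load≤makespan (L ∘ suc) i) (p≤q⊔p (L zero) _)

makespan-nonNeg : ∀ {k} (L : Loads (suc k)) → (∀ i → 0ℚ ≤ L i) → 0ℚ ≤ makespan L
makespan-nonNeg L 0≤L = ≤-trans (0≤L zero) (load≤makespan L zero)

makespan-attained : ∀ {k} (L : Loads (suc k)) → ∃ λ i → makespan L ≡ L i
makespan-attained {zero}  L = zero , refl
makespan-attained {suc k} L with ⊔-sel (L zero) (makespan (L ∘ suc)) | makespan-attained (L ∘ suc)
... | inj₁ ≡L₀    | _          = zero , ≡L₀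
... | inj₂ ≡rest  | (i , ≡Lᵢ)  = suc i , trans ≡rest ≡Lᵢ

work : List ℚ → ℚ
work = foldr _+_ 0ℚ

volume : ∀ {m} → Speeds m → Loads m → ℚ
volume s L = sum (λ i → proj₁ (s i) * L i)

volume-zeroLoads : ∀ {m} (s : Speeds m) → volume s zeroLoads ≡ 0ℚ
volume-zeroLoads {m} s = trans (sum-cong-≗ (λ i → *-zeroʳ (proj₁ (s i)))) (sum-replicate-zero m)

volume-addJob : ∀ {k} (s : Speeds (suc k)) L r p → volume s (addJob s L r p) ≡ volume s L + p
volume-addJob s L r p = begin
  sum w′                          ≡⟨ sum-remove w′ ⟩
  w′ r + sum (w′ ∘ punchIn r)     ≡⟨ cong₂ _+_ w′r≡wr+p (sum-cong-≗ λ j → w′≡w (punchInᵢ≢i r j)) ⟩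
  w r + p + sum (w ∘ punchIn r)   ≡⟨ solve 3 (λ a p b → a :+ p :+ b := a :+ b :+ p) refl (w r) p _ ⟩
  w r + sum (w ∘ punchIn r) + p   ≡⟨ cong (_+ p) (sum-remove w) ⟨
  sum w + p                       ∎
  where
  open ≡-Reasoning
  open +-*-Solver
  w w′ : Fin _ → ℚ
  w  i = proj₁ (s i) * L i
  w′ i = proj₁ (s i) * addJob s L r p i
  w′r≡wr+p : w′ r ≡ w r + p
  w′r≡wr+p = begin
    proj₁ (s r) * addJob s L r p r                         ≡⟨ cong (_*_ (proj₁ (s r))) (addJob-hit s L r p) ⟩
    proj₁ (s r) * (L r + timeOn p (s r))                   ≡⟨ *-distribˡ-+ (proj₁ (s r)) (L r) _ ⟩
    proj₁ (s r) * L r + proj₁ (s r) * timeOn p (s r)       ≡⟨ cong (_+_ (w r)) (speed*timeOn p (s r)) ⟩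
    w r + p                                                ∎
  w′≡w : ∀ {i} → i ≢ r → w′ i ≡ w i
  w′≡w {i} i≢r = cong (_*_ (proj₁ (s i))) (addJob-miss s L r p i≢r)

volume-runFrom : ∀ {k} (A : NCAlg (suc k)) s L ps → volume s (runFrom A s L ps) ≡ volume s L + work ps
volume-runFrom A s L []       = sym (+-identityʳ (volume s L))
volume-runFrom A s L (p ∷ ps) = begin
  volume s (runFrom A s L′ ps)  ≡⟨ volume-runFrom A s L′ ps ⟩
  volume s L′ + work ps         ≡⟨ cong (_+ work ps) (volume-addJob s L (A s L) p) ⟩
  volume s L + p + work ps      ≡⟨ +-assoc (volume s L) p (work ps) ⟩
  volume s L + (p + work ps)    ∎
  where
  open ≡-Reasoning
  L′ = addJob s L (A s L) p

volume-assignLoads : ∀ {k} (s : Speeds (suc k)) ps σ → volume s (assignLoads s ps σ) ≡ work ps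
volume-assignLoads s []       σ = volume-zeroLoads s
volume-assignLoads s (p ∷ ps) σ = begin
  volume s (addJob s L (σ zero) p)  ≡⟨ volume-addJob s L (σ zero) p ⟩
  volume s L + p                    ≡⟨ cong (_+ p) (volume-assignLoads s ps (σ ∘ suc)) ⟩
  work ps + p                       ≡⟨ +-comm (work ps) p ⟩
  p + work ps                       ∎
  where
  open ≡-Reasoning
  L = assignLoads s ps (σ ∘ suc)

volume-runAlg : ∀ {k} (A : NCAlg (suc k)) s ps σ → volume s (runAlg A s ps) ≡ volume s (assignLoads s ps σ)
volume-runAlg A s ps σ = begin
  volume s (runAlg A s ps)        ≡⟨ volume-runFrom A s zeroLoads ps ⟩
  volume s zeroLoads + work ps    ≡⟨ cong (_+ work ps) (volume-zeroLoads s) ⟩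
  0ℚ + work ps                    ≡⟨ +-identityˡ (work ps) ⟩
  work ps                         ≡⟨ volume-assignLoads s ps σ ⟨
  volume s (assignLoads s ps σ)   ∎
  where open ≡-Reasoning

volume≤totalSpeed*makespan : ∀ {k} (s : Speeds (suc k)) L →
                             volume s L ≤ sum (proj₁ ∘ s) * makespan L
volume≤totalSpeed*makespan s L = begin
  sum (λ i → proj₁ (s i) * L i)           ≤⟨ sum-mono-≤ (λ i → speed*-mono-≤ (s i) (load≤makespan L i)) ⟩
  sum (λ i → proj₁ (s i) * makespan L)    ≡⟨ *-distribʳ-sum (makespan L) (proj₁ ∘ s) ⟨
  sum (proj₁ ∘ s) * makespan L            ∎
  where open ≤-Reasoning

module FastMachines {k} (Q : ℚ) (s : Speeds (suc k)) where

  speedOf : Fin (suc k) → ℚ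
  speedOf i = proj₁ (s i)

  -- Opaque because type checking otherwise keeps unfolding the comparisons inside argmax,
  -- which is prohibitively slow.
  opaque
    fastest : Fin (suc k)
    fastest = argmax speedOf zero (allFin (suc k))

  maxSpeed : ℚ
  maxSpeed = speedOf fastest

  opaque
    unfolding fastest

    speedOf≤maxSpeed : ∀ i → speedOf i ≤ maxSpeed
    speedOf≤maxSpeed i = All.lookup (f[xs]≤f[argmax] {f = speedOf} zero (allFin (suc k))) (∈-allFin i)

  IsFast : Fin (suc k) → Set
  IsFast i = maxSpeed ≤ Q * speedOf i

  isFast? : Decidable IsFast
  isFast? i = maxSpeed ≤? Q * speedOf i

  leastLoadedFast : Loads (suc k) → Fin (suc k)
  leastLoadedFast L = argmin L fastest (filter isFast? (allFin (suc k)))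

fastGreedy : ∀ {k} → ℚ → NCAlg (suc k)
fastGreedy Q s = FastMachines.leastLoadedFast Q s

module FastGreedyAnalysis {k} (Q : ℚ) (1≤Q : 1ℚ ≤ Q) (s : Speeds (suc k)) where

  open FastMachines Q s

  0<Q : 0ℚ < Q
  0<Q = <-≤-trans (positive⁻¹ 1ℚ) 1≤Q

  Q*-mono-≤ : ∀ {p q} → p ≤ q → Q * p ≤ Q * q
  Q*-mono-≤ = *-monoˡ-≤-nonNeg Q {{nonNegative (<⇒≤ 0<Q)}}

  fastest-isFast : IsFast fastest
  fastest-isFast = begin
    maxSpeed       ≡⟨ *-identityˡ maxSpeed ⟨
    1ℚ * maxSpeed  ≤⟨ *-monoʳ-≤-nonNeg maxSpeed {{speed-nonNeg (s fastest)}} 1≤Q ⟩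
    Q * maxSpeed   ∎
    where open ≤-Reasoning

  leastLoadedFast-isFast : ∀ L → IsFast (leastLoadedFast L)
  leastLoadedFast-isFast L = argmin-all L fastest-isFast (all-filter isFast? (allFin (suc k)))

  leastLoadedFast-least : ∀ L {j} → IsFast j → L (leastLoadedFast L) ≤ L j
  leastLoadedFast-least L {j} fast =
    All.lookup (f[argmin]≤f[xs] {f = L} fastest _) (∈-filter⁺ isFast? (∈-allFin j) fast)

  jobs≤maxSpeed*makespan : ∀ ps σ → All (0ℚ ≤_) ps → All (_≤ maxSpeed * makespan (assignLoads s ps σ)) ps
  jobs≤maxSpeed*makespan ps σ 0≤ps = All.map job≤ (assignLoads-jobs s ps σ 0≤ps)
    where
    Lσ = assignLoads s ps σ
    job≤ : ∀ {p} → ∃ (λ i → timeOn p (s i) ≤ Lσ i) → p ≤ maxSpeed * makespan Lσ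
    job≤ {p} (i , le) = begin
      p                              ≡⟨ speed*timeOn p (s i) ⟨
      speedOf i * timeOn p (s i)     ≤⟨ speed*-mono-≤ (s i) (≤-trans le (load≤makespan Lσ i)) ⟩
      speedOf i * makespan Lσ        ≤⟨ *-monoʳ-≤-nonNeg (makespan Lσ) {{Lσ-nonNeg}} (speedOf≤maxSpeed i) ⟩
      maxSpeed * makespan Lσ         ∎
      where
      open ≤-Reasoning
      Lσ-nonNeg = nonNegative (makespan-nonNeg Lσ (assignLoads-nonNeg s ps σ 0≤ps))

  record Balanced (c : ℚ) (L : Loads (suc k)) : Set where
    field
      idle  : ∀ {i} → ¬ IsFast i → L i ≡ 0ℚ
      close : ∀ {i j} → IsFast i → IsFast j → L i ≤ L j + timeOn c (s i)

  balanced-zeroLoads : ∀ {c} → 0ℚ ≤ c → Balanced c zeroLoads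
  balanced-zeroLoads 0≤c = record
    { idle  = λ _ → refl
    ; close = λ {i} _ _ → p≤p+q (timeOn-nonNeg (s i) 0≤c)
    }

  balanced-addJob : ∀ {c L p r} → IsFast r → (∀ {j} → IsFast j → L r ≤ L j) →
                    0ℚ ≤ p → p ≤ c → Balanced c L → Balanced c (addJob s L r p)
  balanced-addJob {c} {L} {p} {r} fast-r least 0≤p p≤c bal = record { idle = idle′ ; close = close′ }
    where
    open Balanced bal
    open ≤-Reasoning
    L′ = addJob s L r p
    idle′ : ∀ {i} → ¬ IsFast i → L′ i ≡ 0ℚ
    idle′ slow = trans (addJob-miss s L r p (λ { refl → slow fast-r })) (idle slow)
    close-chosen : ∀ {j} → IsFast j → L′ r ≤ L′ j + timeOn c (s r)
    close-chosen {j} fast-j = begin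
      L′ r                   ≡⟨ addJob-hit s L r p ⟩
      L r + timeOn p (s r)   ≤⟨ +-mono-≤ (least fast-j) (timeOn-mono-≤ (s r) p≤c) ⟩
      L j + timeOn c (s r)   ≤⟨ +-monoˡ-≤ _ (addJob-inflationary s L r 0≤p j) ⟩
      L′ j + timeOn c (s r)  ∎
    close-other : ∀ {i j} → i ≢ r → IsFast i → IsFast j → L′ i ≤ L′ j + timeOn c (s i)
    close-other {i} {j} i≢r fast-i fast-j = begin
      L′ i                   ≡⟨ addJob-miss s L r p i≢r ⟩
      L i                    ≤⟨ close fast-i fast-j ⟩
      L j + timeOn c (s i)   ≤⟨ +-monoˡ-≤ _ (addJob-inflationary s L r 0≤p j) ⟩
      L′ j + timeOn c (s i)  ∎
    close′ : ∀ {i j} → IsFast i → IsFast j → L′ i ≤ L′ j + timeOn c (s i)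
    close′ {i} fast-i fast-j = case i ≟ r of λ where
      (yes refl) → close-chosen fast-j
      (no i≢r)   → close-other i≢r fast-i fast-j

  balanced-runFrom : ∀ {c L} ps → All (0ℚ ≤_) ps → All (_≤ c) ps → Balanced c L →
                     Balanced c (runFrom (fastGreedy Q) s L ps)
  balanced-runFrom []       []           []           bal = bal
  balanced-runFrom {L = L} (p ∷ ps) (0≤p ∷ 0≤ps) (p≤c ∷ ps≤c) bal =
    balanced-runFrom ps 0≤ps ps≤c
      (balanced-addJob (leastLoadedFast-isFast L) (leastLoadedFast-least L) 0≤p p≤c bal)

  fastSpeed : Fin (suc k) → ℚ
  fastSpeed i with isFast? i
  ... | yes _ = speedOf i
  ... | no _  = 0ℚ

  fastSpeed-nonNeg : ∀ i → 0ℚ ≤ fastSpeed i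
  fastSpeed-nonNeg i with isFast? i
  ... | yes _ = <⇒≤ (speed>0 (s i))
  ... | no _  = ≤-refl

  maxSpeed≤fastSpeedSum : maxSpeed ≤ sum fastSpeed
  maxSpeed≤fastSpeedSum = ≤-trans (≤-reflexive maxSpeed≡fastSpeed) (≤-sum fastSpeed-nonNeg fastest)
    where
    maxSpeed≡fastSpeed : maxSpeed ≡ fastSpeed fastest
    maxSpeed≡fastSpeed with isFast? fastest
    ... | yes _   = refl
    ... | no slow = contradiction fastest-isFast slow

  Q*totalSpeed≤ : Q * sum speedOf ≤ Q * sum fastSpeed + fromℕ (suc k) * maxSpeed
  Q*totalSpeed≤ = begin
    Q * sum speedOf                                       ≡⟨ *-distribˡ-sum Q speedOf ⟩
    sum (λ i → Q * speedOf i)                             ≤⟨ sum-mono-≤ Q*speedOf≤ ⟩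
    sum (λ i → Q * fastSpeed i + maxSpeed)                ≡⟨ ∑-distrib-+ (λ i → Q * fastSpeed i) (λ _ → maxSpeed) ⟩
    sum (λ i → Q * fastSpeed i) + sum {suc k} (λ _ → maxSpeed)
                                                          ≡⟨ cong₂ _+_ (*-distribˡ-sum Q fastSpeed) (sym (sum-const (suc k) maxSpeed)) ⟨
    Q * sum fastSpeed + fromℕ (suc k) * maxSpeed          ∎
    where
    open ≤-Reasoning
    Q*speedOf≤ : ∀ i → Q * speedOf i ≤ Q * fastSpeed i + maxSpeed
    Q*speedOf≤ i with isFast? i
    ... | yes _   = p≤p+q (<⇒≤ (speed>0 (s fastest)))
    ... | no slow = subst (Q * speedOf i ≤_) M≡Q*0+M (<⇒≤ (≰⇒> slow))
      where
      M≡Q*0+M : maxSpeed ≡ Q * 0ℚ + maxSpeed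
      M≡Q*0+M = sym (trans (cong (_+ maxSpeed) (*-zeroʳ Q)) (+-identityˡ maxSpeed))

  fastSpeedSum-volume : ∀ {a} L → (∀ i → 0ℚ ≤ L i) → (∀ {i} → IsFast i → a ≤ L i) →
                        a * sum fastSpeed ≤ volume s L
  fastSpeedSum-volume {a} L 0≤L a≤fast = begin
    a * sum fastSpeed            ≡⟨ *-distribˡ-sum a fastSpeed ⟩
    sum (λ i → a * fastSpeed i)  ≤⟨ sum-mono-≤ a*fastSpeed≤ ⟩
    volume s L                   ∎
    where
    open ≤-Reasoning
    a*fastSpeed≤ : ∀ i → a * fastSpeed i ≤ speedOf i * L i
    a*fastSpeed≤ i with isFast? i
    ... | yes fast = subst (_≤ speedOf i * L i) (*-comm (speedOf i) a) (speed*-mono-≤ (s i) (a≤fast fast))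
    ... | no _     = subst₂ _≤_ (trans (*-zeroʳ (speedOf i)) (sym (*-zeroʳ a))) refl (speed*-mono-≤ (s i) (0≤L i))

  least-fast-load-bound : ∀ {a T} → 0ℚ ≤ T → a * sum fastSpeed ≤ sum speedOf * T →
                          Q * a ≤ (Q + fromℕ (suc k)) * T
  least-fast-load-bound {a} {T} 0≤T a*F≤ = *-cancelˡ-≤-pos F {{positive 0<F}} (begin
    F * (Q * a)                 ≡⟨ solve 3 (λ f q a → f :* (q :* a) := q :* (a :* f)) refl F Q a ⟩
    Q * (a * F)                 ≤⟨ Q*-mono-≤ a*F≤ ⟩
    Q * (sum speedOf * T)       ≡⟨ *-assoc Q (sum speedOf) T ⟨
    Q * sum speedOf * T         ≤⟨ T*-mono-≤ Q*totalSpeed≤ ⟩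
    (Q * F + m * maxSpeed) * T  ≤⟨ T*-mono-≤ (+-monoʳ-≤ (Q * F) m*M≤m*F) ⟩
    (Q * F + m * F) * T         ≡⟨ solve 4 (λ f q m t → (q :* f :+ m :* f) :* t := f :* ((q :+ m) :* t)) refl F Q m T ⟩
    F * ((Q + m) * T)           ∎)
    where
    open ≤-Reasoning
    open +-*-Solver
    F = sum fastSpeed
    m = fromℕ (suc k)
    0<F : 0ℚ < F
    0<F = <-≤-trans (speed>0 (s fastest)) maxSpeed≤fastSpeedSum
    T*-mono-≤ : ∀ {p q} → p ≤ q → p * T ≤ q * T
    T*-mono-≤ = *-monoʳ-≤-nonNeg T {{nonNegative 0≤T}}
    m*M≤m*F : m * maxSpeed ≤ m * F
    m*M≤m*F = *-monoˡ-≤-nonNeg m {{nonNegative (fromℕ-nonNeg (suc k))}} maxSpeed≤fastSpeedSum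

  timeOn-slack : ∀ {i T} → IsFast i → 0ℚ ≤ T → timeOn (maxSpeed * T) (s i) ≤ Q * T
  timeOn-slack {i} {T} fast 0≤T = timeOn-≤ (s i) (begin
    maxSpeed * T         ≤⟨ *-monoʳ-≤-nonNeg T {{nonNegative 0≤T}} fast ⟩
    Q * speedOf i * T    ≡⟨ solve 3 (λ q v t → q :* v :* t := v :* (q :* t)) refl Q (speedOf i) T ⟩
    speedOf i * (Q * T)  ∎)
    where
    open ≤-Reasoning
    open +-*-Solver

  fast-load-bound : ∀ {T L i} → 0ℚ ≤ T → Balanced (maxSpeed * T) L → IsFast i →
                    Q * L (leastLoadedFast L) ≤ (Q + fromℕ (suc k)) * T →
                    Q * L i ≤ (Q + fromℕ (suc k) + Q * Q) * T
  fast-load-bound {T} {L} {i} 0≤T bal fast Q*a≤ = begin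
    Q * L i                                ≤⟨ Q*-mono-≤ (close fast (leastLoadedFast-isFast L)) ⟩
    Q * (a + timeOn (maxSpeed * T) (s i))  ≤⟨ Q*-mono-≤ (+-monoʳ-≤ a (timeOn-slack fast 0≤T)) ⟩
    Q * (a + Q * T)                        ≡⟨ *-distribˡ-+ Q a (Q * T) ⟩
    Q * a + Q * (Q * T)                    ≤⟨ +-monoˡ-≤ (Q * (Q * T)) Q*a≤ ⟩
    (Q + m) * T + Q * (Q * T)              ≡⟨ solve 3 (λ q m t → (q :+ m) :* t :+ q :* (q :* t) := (q :+ m :+ q :* q) :* t) refl Q m T ⟩
    (Q + m + Q * Q) * T                    ∎
    where
    open Balanced bal
    open ≤-Reasoning
    open +-*-Solver
    a = L (leastLoadedFast L)
    m = fromℕ (suc k)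

  fastGreedy-bound : ∀ ps σ → All (0ℚ ≤_) ps →
                     Q * makespan (runAlg (fastGreedy Q) s ps)
                       ≤ (Q + fromℕ (suc k) + Q * Q) * makespan (assignLoads s ps σ)
  fastGreedy-bound ps σ 0≤ps = begin
    Q * makespan L  ≡⟨ cong (_*_ Q) (proj₂ (makespan-attained L)) ⟩
    Q * L _         ≤⟨ load-bound (proj₁ (makespan-attained L)) ⟩
    K * T           ∎
    where
    open ≤-Reasoning
    Lσ = assignLoads s ps σ
    T  = makespan Lσ
    0≤T : 0ℚ ≤ T
    0≤T = makespan-nonNeg Lσ (assignLoads-nonNeg s ps σ 0≤ps)
    L = runAlg (fastGreedy Q) s ps
    0≤L : ∀ i → 0ℚ ≤ L i
    0≤L = runFrom-nonNeg (fastGreedy Q) s ps 0≤ps (λ _ → ≤-refl)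
    bal : Balanced (maxSpeed * T) L
    bal = balanced-runFrom ps 0≤ps (jobs≤maxSpeed*makespan ps σ 0≤ps)
            (balanced-zeroLoads (subst (_≤ maxSpeed * T) (*-zeroʳ maxSpeed) (speed*-mono-≤ (s fastest) 0≤T)))
    open Balanced bal
    a = L (leastLoadedFast L)
    m = fromℕ (suc k)
    K = Q + m + Q * Q
    Q*a≤ : Q * a ≤ (Q + m) * T
    Q*a≤ = least-fast-load-bound 0≤T (begin
      a * sum fastSpeed  ≤⟨ fastSpeedSum-volume L 0≤L (leastLoadedFast-least L) ⟩
      volume s L         ≡⟨ volume-runAlg (fastGreedy Q) s ps σ ⟩
      volume s Lσ        ≤⟨ volume≤totalSpeed*makespan s Lσ ⟩
      sum speedOf * T    ∎)
    load-bound : ∀ i → Q * L i ≤ K * T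
    load-bound i with isFast? i
    ... | yes fast = fast-load-bound 0≤T bal fast Q*a≤
    ... | no slow  = ≤-trans (Q*-mono-≤ (subst (_≤ L fastest) (sym (idle slow)) (0≤L fastest)))
                             (fast-load-bound 0≤T bal fastest-isFast Q*a≤)

module SqrtGreedy (k : ℕ) where

  q : ℕ
  q = proj₁ (approx-sqrt k)

  1≤q : 1 ℕ.≤ q
  1≤q = proj₁ (proj₂ (approx-sqrt k))

  m≤q² : suc k ℕ.≤ q ℕ.* q
  m≤q² = proj₁ (proj₂ (proj₂ (approx-sqrt k)))

  q²≤4m : q ℕ.* q ℕ.≤ 4 ℕ.* suc k
  q²≤4m = proj₂ (proj₂ (proj₂ (approx-sqrt k)))

  q+m+q²≤q*3q : q ℕ.+ suc k ℕ.+ q ℕ.* q ℕ.≤ q ℕ.* (3 ℕ.* q)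
  q+m+q²≤q*3q = begin
    q ℕ.+ suc k ℕ.+ q ℕ.* q            ≤⟨ ℕₚ.+-monoˡ-≤ (q ℕ.* q) (ℕₚ.+-mono-≤ (ℕₚ.m≤m*n q q {{ℕ.>-nonZero 1≤q}}) m≤q²) ⟩
    q ℕ.* q ℕ.+ q ℕ.* q ℕ.+ q ℕ.* q    ≡⟨ solve 1 (λ x → x :* x :+ x :* x :+ x :* x := x :* (con 3 :* x)) refl q ⟩
    q ℕ.* (3 ℕ.* q)                    ∎
    where
    open ℕₚ.≤-Reasoning
    open Data.Nat.Solver.+-*-Solver

  3q*3q≤36m : 3 ℕ.* q ℕ.* (3 ℕ.* q) ℕ.≤ 6 ℕ.* 6 ℕ.* suc k
  3q*3q≤36m = begin
    3 ℕ.* q ℕ.* (3 ℕ.* q)  ≡⟨ solve 1 (λ x → con 3 :* x :* (con 3 :* x) := con 9 :* (x :* x)) refl q ⟩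
    9 ℕ.* (q ℕ.* q)        ≤⟨ ℕₚ.*-monoʳ-≤ 9 q²≤4m ⟩
    9 ℕ.* (4 ℕ.* suc k)    ≡⟨ solve 1 (λ x → con 9 :* (con 4 :* x) := con 6 :* con 6 :* x) refl (suc k) ⟩
    6 ℕ.* 6 ℕ.* suc k      ∎
    where
    open ℕₚ.≤-Reasoning
    open Data.Nat.Solver.+-*-Solver

  algorithm : NCAlg (suc k)
  algorithm = fastGreedy (fromℕ q)

  makespan-bound : ∀ s ps σ → All (0ℚ ≤_) ps →
                   makespan (runAlg algorithm s ps) ≤ fromℕ (3 ℕ.* q) * makespan (assignLoads s ps σ)
  makespan-bound s ps σ 0≤ps = *-cancelˡ-≤-pos Q {{positive 0<Q}} (begin
    Q * X                      ≤⟨ fastGreedy-bound ps σ 0≤ps ⟩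
    (Q + m + Q * Q) * T        ≤⟨ *-monoʳ-≤-nonNeg T {{nonNegative 0≤T}} coefficient ⟩
    Q * fromℕ (3 ℕ.* q) * T    ≡⟨ *-assoc Q _ T ⟩
    Q * (fromℕ (3 ℕ.* q) * T)  ∎)
    where
    open ≤-Reasoning
    Q = fromℕ q
    m = fromℕ (suc k)
    open FastGreedyAnalysis Q (fromℕ-mono-≤ 1≤q) s
    X = makespan (runAlg algorithm s ps)
    T = makespan (assignLoads s ps σ)
    0≤T : 0ℚ ≤ T
    0≤T = makespan-nonNeg _ (assignLoads-nonNeg s ps σ 0≤ps)
    coefficient : Q + m + Q * Q ≤ Q * fromℕ (3 ℕ.* q)
    coefficient = subst₂ _≤_
      (trans (fromℕ-+ (q ℕ.+ suc k) (q ℕ.* q)) (cong₂ _+_ (fromℕ-+ q (suc k)) (fromℕ-* q q)))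
      (fromℕ-* q (3 ℕ.* q))
      (fromℕ-mono-≤ q+m+q²≤q*3q)

  squared-makespan-bound : ∀ s ps → All (0ℚ ≤_) ps → ∀ σ →
    makespan (runAlg algorithm s ps) * makespan (runAlg algorithm s ps)
      ≤ fromℕ (6 ℕ.* 6 ℕ.* suc k) * (makespan (assignLoads s ps σ) * makespan (assignLoads s ps σ))
  squared-makespan-bound s ps 0≤ps σ = begin
    X * X                                ≤⟨ square-mono-≤ 0≤X (makespan-bound s ps σ 0≤ps) ⟩
    fromℕ (3 ℕ.* q) * T * (fromℕ (3 ℕ.* q) * T)
                                         ≡⟨ solve 2 (λ b t → b :* t :* (b :* t) := b :* b :* (t :* t)) refl (fromℕ (3 ℕ.* q)) T ⟩
    fromℕ (3 ℕ.* q) * fromℕ (3 ℕ.* q) * (T * T)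
                                         ≡⟨ cong (_* (T * T)) (fromℕ-* (3 ℕ.* q) (3 ℕ.* q)) ⟨
    fromℕ (3 ℕ.* q ℕ.* (3 ℕ.* q)) * (T * T)
                                         ≤⟨ *-monoʳ-≤-nonNeg (T * T) {{T*T-nonNeg}} (fromℕ-mono-≤ 3q*3q≤36m) ⟩
    fromℕ (6 ℕ.* 6 ℕ.* suc k) * (T * T)  ∎
    where
    open ≤-Reasoning
    open +-*-Solver
    X = makespan (runAlg algorithm s ps)
    T = makespan (assignLoads s ps σ)
    0≤X : 0ℚ ≤ X
    0≤X = makespan-nonNeg _ (runFrom-nonNeg algorithm s ps 0≤ps (λ _ → ≤-refl))
    T*T-nonNeg : NonNegative (T * T)
    T*T-nonNeg = nonNeg*nonNeg⇒nonNeg T T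
      where
      instance
        T-nonNeg : NonNegative T
        T-nonNeg = nonNegative (makespan-nonNeg _ (assignLoads-nonNeg s ps σ 0≤ps))

mainTheorem9 : ∃ λ (C : ℕ) → ∀ (k : ℕ) → Σ (NCAlg (suc k)) λ A →
    ∀ (s : Speeds (suc k)) (ps : List ℚ) → All (0ℚ ≤_) ps →
    ∀ (σ : Fin (length ps) → Fin (suc k)) →
    makespan (runAlg A s ps) * makespan (runAlg A s ps)
    ≤ ((+ (C ℕ.* C ℕ.* suc k)) / 1) * (makespan (assignLoads s ps σ) * makespan (assignLoads s ps σ))
mainTheorem9 = 6 , λ k → SqrtGreedy.algorithm k , SqrtGreedy.squared-makespan-bound k
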